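{- Let $M$ be a simple matroid and $F\in L(M)$ a flat. Then the element \[\zeta^F=\sum_{G\in L(M),\,G\subseteq F}t^{\operatorname{rk}F-\operatorname{rk}G}\,P_{M^F_G}(t^{ -2})\cdot G\] of $\mathcal H(M)$ lies in $\mathcal H_p(M)$.
   Context: $L(M)$ is the lattice of flats with rank function $\operatorname{rk}$. For flats $G\subseteq F$, $M^F_G$ is the matroid whose lattice of flats is isomorphic to the interval $\{H\in L(M)\mid G\subseteq H\subseteq F\}$ (contraction at $G$ of the localization at $F$). $P_N(t)$ is the Kazhdan–Lusztig polynomial: the unique family with $P_N=1$ if $\operatorname{rk}N=0$, $\deg P_N<(\operatorname{rk}N)/2$ if $\operatorname{rk}N>0$, and $Z_N(t)=\sum_{F\in L(N)}t^{\operatorname{rk}F}P_{N_F}(t)$ satisfying $Z_N(t)=t^{\operatorname{rk}N}Z_N(t^{ -1})$ ($N_F$ the contraction at $F$). $\mathcal H(M)$ is the free $\mathbb Z[t,t^{ -1}]$-module with basis $L(M)$; elements are written $\alpha=\sum_F\alpha_F\cdot F$. $\mathsf{Pal}(0)$ is the set of $h\in\mathbb Z[t,t^{ -1}]$ with $h(t)=h(t^{ -1})$. $\mathcal H_p(M)\subset\mathcal H(M)$ is the set of $\alpha$ such that for every flat $F$, $\alpha_F\in\mathbb Z[t]$ and $\sum_{G\supseteq F}t^{\operatorname{rk}F-\operatorname{rk}G}\alpha_G\in\mathsf{Pal}(0)$. -}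

module Defs where

open import Data.Nat as ℕ using (ℕ; zero; suc; _<_; _≤_)
open import Data.Nat.Properties as ℕP using ()
open import Data.Integer as ℤ using (ℤ; +_; _-_)
import Data.Integer.Properties as ℤP
open import Data.Fin using (Fin)
open import Data.Fin.Properties using (all?)
open import Data.Fin.Subset using (Subset; _∈_; _∉_; _⊆_; _∪_; _∩_; ⁅_⁆; ∣_∣; ⊥; inside; outside)
open import Data.Fin.Subset.Properties using (_∈?_; _⊆?_)
open import Data.List using (List; []; _∷_; _++_; map; filter; cartesianProductWith; concatMap)
open import Data.Vec using (Vec; []; _∷_)
open import Data.Product using (_×_; _,_; proj₁; proj₂)
open import Data.Bool using (Bool; true; false; if_then_else_)
open import Relation.Binary.PropositionalEquality using (_≡_)
open import Relation.Nullary using (Dec; yes; no; does; ¬_)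
open import Relation.Nullary.Decidable using (¬?; _→-dec_)

record Matroid (n : ℕ) : Set where
  field
    rk       : Subset n → ℕ
    rk-bound : ∀ X → rk X ≤ ∣ X ∣
    rk-mono  : ∀ {X Y} → X ⊆ Y → rk X ≤ rk Y
    rk-submod : ∀ X Y → rk (X ∪ Y) ℕ.+ rk (X ∩ Y) ≤ rk X ℕ.+ rk Y

open Matroid public

Simple : ∀ {n} → Matroid n → Set
Simple M = (∀ e → rk M ⁅ e ⁆ ≡ 1)
         × (∀ e f → ¬ (e ≡ f) → rk M (⁅ e ⁆ ∪ ⁅ f ⁆) ≡ 2)

IsFlat : ∀ {n} → Matroid n → Subset n → Set
IsFlat M F = ∀ e → e ∉ F → rk M F < rk M (F ∪ ⁅ e ⁆)

isFlat? : ∀ {n} (M : Matroid n) (F : Subset n) → Dec (IsFlat M F)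
isFlat? M F = all? (λ e → ¬? (e ∈? F) →-dec (rk M F ℕP.<? rk M (F ∪ ⁅ e ⁆)))

allSubsets : ∀ n → List (Subset n)
allSubsets zero = [] ∷ []
allSubsets (suc n) = map (outside ∷_) (allSubsets n) ++ map (inside ∷_) (allSubsets n)

-- the lattice of flats L(M), as a list (each flat exactly once)
flats : ∀ {n} → Matroid n → List (Subset n)
flats {n} M = filter (isFlat? M) (allSubsets n)

-- Laurent polynomials Z[t,t⁻¹] as formal sums of terms (coefficient, exponent);
-- they are compared through their coefficients.

Laurent : Set
Laurent = List (ℤ × ℤ)

coeff : Laurent → ℤ → ℤ
coeff [] k = + 0
coeff ((c , e) ∷ p) k = (if does (e ℤ.≟ k) then c else + 0) ℤ.+ coeff p k

0L : Laurent
0L = []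

1L : Laurent
1L = (+ 1 , + 0) ∷ []

tpow : ℤ → Laurent
tpow m = (+ 1 , m) ∷ []

_⊕_ : Laurent → Laurent → Laurent
p ⊕ q = p ++ q

_⊗_ : Laurent → Laurent → Laurent
p ⊗ q = cartesianProductWith (λ a b → (proj₁ a ℤ.* proj₁ b , proj₂ a ℤ.+ proj₂ b)) p q

Σ[_]_ : ∀ {A : Set} → List A → (A → Laurent) → Laurent
Σ[ xs ] f = concatMap f xs

subst-t⁻² : Laurent → Laurent
subst-t⁻² = map (λ a → (proj₁ a , ℤ.- (+ 2 ℤ.* proj₂ a)))

_≈L_ : Laurent → Laurent → Set
p ≈L q = ∀ k → coeff p k ≡ coeff q k

IsPoly : Laurent → Set
IsPoly p = ∀ k → k ℤ.< + 0 → coeff p k ≡ + 0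

Pal0 : Laurent → Set
Pal0 p = ∀ k → coeff p k ≡ coeff p (ℤ.- k)

PalDeg : ℕ → Laurent → Set
PalDeg r p = ∀ k → coeff p k ≡ coeff p (+ r - k)

DegLtHalf : ℕ → Laurent → Set
DegLtHalf r p = ∀ k → + r ℤ.≤ + 2 ℤ.* k → coeff p k ≡ + 0

-- The lattice of flats of M^F_G is the interval [G,F] of L(M), its rank is
-- rk F - rk G, and the contraction of M^F_G at a flat H ∈ [G,F] is M^F_H.
-- A family P with P G F standing for P_{M^F_G} is the KL family iff it
-- satisfies the defining conditions (which determine it uniquely).

rkℤ : ∀ {n} → Matroid n → Subset n → ℤ
rkℤ M X = + rk M X

interval : ∀ {n} → Matroid n → Subset n → Subset n → List (Subset n)
interval M G F = filter (λ H → (G ⊆? H) ×-d (H ⊆? F)) (flats M)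
  where
  open import Relation.Nullary.Decidable using (_×-dec_)
  _×-d_ = _×-dec_

Zfun : ∀ {n} → Matroid n → (Subset n → Subset n → Laurent) → Subset n → Subset n → Laurent
Zfun M P G F = Σ[ interval M G F ] (λ H → tpow (rkℤ M H - rkℤ M G) ⊗ P H F)

record IsKLFamily {n} (M : Matroid n) (P : Subset n → Subset n → Laurent) : Set where
  field
    poly    : ∀ G F → IsFlat M G → IsFlat M F → G ⊆ F → IsPoly (P G F)
    rank0   : ∀ G F → IsFlat M G → IsFlat M F → G ⊆ F → rk M F ≡ rk M G → P G F ≈L 1L
    degree  : ∀ G F → IsFlat M G → IsFlat M F → G ⊆ F → rk M G < rk M F →
              DegLtHalf (rk M F ℕ.∸ rk M G) (P G F)
    palin   : ∀ G F → IsFlat M G → IsFlat M F → G ⊆ F →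
              PalDeg (rk M F ℕ.∸ rk M G) (Zfun M P G F)

-- H(M): elements are coefficient functions on L(M)  (α = Σ_F α_F · F)

HElem : ∀ {n} → Matroid n → Set
HElem {n} M = Subset n → Laurent

InHp : ∀ {n} (M : Matroid n) → HElem M → Set
InHp {n} M α = ∀ F → IsFlat M F →
  IsPoly (α F) ×
  Pal0 (Σ[ filter (F ⊆?_) (flats M) ] (λ G → tpow (rkℤ M F - rkℤ M G) ⊗ α G))

ζ : ∀ {n} (M : Matroid n) → (Subset n → Subset n → Laurent) → Subset n → HElem M
ζ M P F G with G ⊆? F
... | yes _ = tpow (rkℤ M F - rkℤ M G) ⊗ subst-t⁻² (P G F)
... | no  _ = 0L

-- Each coefficient of ζ^F has the form t^r p(t⁻²) with r = rk F − rk G and p = P_{M^F_G}.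
-- Such a twist is a polynomial since deg p < r/2 (or p = 1 when r = 0).  The upper sum
-- Σ_{H ⊇ G} t^{rk G − rk H} ζ^F_H equals t^r Z_{M^F_G}(t⁻²), and t^r Z(t⁻²) is invariant
-- under t ↦ t⁻¹ exactly because Z(t) = t^r Z(t⁻¹).
module Submission where

open import Defs
open import Data.Nat using (_∸_)
import Data.Nat.Properties as ℕP
open import Data.Integer using (ℤ; +_; _+_; _*_; -_; _-_; _<_; _≟_; +<+)
import Data.Integer.Properties as ℤP
open import Data.Integer.Divisibility.Signed using (divides; _∣?_)
open import Data.Integer.Tactic.RingSolver using (solve-∀)
open import Data.Fin.Subset using (Subset; _⊆_)
open import Data.Fin.Subset.Properties using (_⊆?_; ⊆-trans)
open import Data.List using ([]; _∷_; _++_; map; filter)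
open import Data.List.Properties using (map-cong; map-∘; map-concatMap; ++-identityʳ)
open import Data.Product using (∃-syntax; _,_; proj₁; proj₂)
open import Data.Sum using (inj₁; inj₂)
open import Data.Empty using (⊥-elim)
open import Function using (_∘_; Injective)
open import Relation.Unary using (Pred; Decidable)
open import Relation.Binary.PropositionalEquality
open import Relation.Nullary using (Dec; yes; no; ¬_; contradiction)
open import Relation.Nullary.Decidable using (_×-dec_)

reindex : (ℤ → ℤ) → Laurent → Laurent
reindex g = map (λ a → proj₁ a , g (proj₂ a))

reindex-∘ : ∀ g h p → reindex g (reindex h p) ≡ reindex (g ∘ h) p
reindex-∘ g h p = sym (map-∘ p)

reindex-cong : ∀ {g h} → (∀ e → g e ≡ h e) → ∀ p → reindex g p ≡ reindex h p
reindex-cong g≗h = map-cong (λ a → cong (proj₁ a ,_) (g≗h (proj₂ a)))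

tpow-⊗ : ∀ m p → tpow m ⊗ p ≡ reindex (_+_ m) p
tpow-⊗ m p = trans (++-identityʳ _)
  (map-cong (λ a → cong (_, m + proj₂ a) (ℤP.*-identityˡ (proj₁ a))) p)

coeff-reindex : ∀ {g} → Injective _≡_ _≡_ g → ∀ p j → coeff (reindex g p) (g j) ≡ coeff p j
coeff-reindex         g-inj []            j = refl
coeff-reindex {g = g} g-inj ((c , e) ∷ p) j with g e ≟ g j | e ≟ j
... | yes _    | yes _   = cong (_+_ c) (coeff-reindex g-inj p j)
... | no _     | no _    = cong (_+_ (+ 0)) (coeff-reindex g-inj p j)
... | yes ge≡gj | no e≢j = contradiction (g-inj ge≡gj) e≢j
... | no ge≢gj | yes e≡j = contradiction (cong g e≡j) ge≢gj

coeff-reindex-∉ : ∀ {g k} → (∀ e → g e ≢ k) → ∀ p → coeff (reindex g p) k ≡ + 0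
coeff-reindex-∉         k∉im []            = refl
coeff-reindex-∉ {g} {k} k∉im ((c , e) ∷ p) with g e ≟ k
... | yes ge≡k = contradiction ge≡k (k∉im e)
... | no _     = trans (ℤP.+-identityˡ _) (coeff-reindex-∉ k∉im p)

coeff-1L : ∀ {j} → j ≢ + 0 → coeff 1L j ≡ + 0
coeff-1L {j} j≢0 with + 0 ≟ j
... | yes 0≡j = contradiction (sym 0≡j) j≢0
... | no _    = refl

twist : ℤ → Laurent → Laurent
twist r = reindex (λ e → r - + 2 * e)

tpow-⊗-subst-t⁻² : ∀ r p → tpow r ⊗ subst-t⁻² p ≡ twist r p
tpow-⊗-subst-t⁻² r p = trans (tpow-⊗ r (subst-t⁻² p)) (reindex-∘ (_+_ r) _ p)

tpow-⊗-twist : ∀ a b p → tpow a ⊗ twist b p ≡ twist (a + b) p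
tpow-⊗-twist a b p = begin
  tpow a ⊗ twist b p                   ≡⟨ tpow-⊗ a (twist b p) ⟩
  reindex (_+_ a) (twist b p)          ≡⟨ reindex-∘ (_+_ a) _ p ⟩
  reindex (λ e → a + (b - + 2 * e)) p  ≡⟨ reindex-cong (λ e → sym (ℤP.+-assoc a b _)) p ⟩
  twist (a + b) p                      ∎
  where open ≡-Reasoning

twist-tpow-⊗ : ∀ a b p → twist b (tpow a ⊗ p) ≡ twist (b - + 2 * a) p
twist-tpow-⊗ a b p = begin
  twist b (tpow a ⊗ p)                 ≡⟨ cong (twist b) (tpow-⊗ a p) ⟩
  twist b (reindex (_+_ a) p)          ≡⟨ reindex-∘ _ (_+_ a) p ⟩
  reindex (λ e → b - + 2 * (a + e)) p  ≡⟨ reindex-cong (distrib a b) p ⟩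
  twist (b - + 2 * a) p                ∎
  where
  open ≡-Reasoning
  distrib : ∀ a b e → b - + 2 * (a + e) ≡ (b - + 2 * a) - + 2 * e
  distrib = solve-∀

r-[r-2e]≡e*2 : ∀ r e → r - (r - + 2 * e) ≡ e * + 2
r-[r-2e]≡e*2 = solve-∀

twist-exponent? : ∀ r k → Dec (∃[ j ] r - + 2 * j ≡ k)
twist-exponent? r k with + 2 ∣? (r - k)
... | yes (divides j r-k≡j*2) = yes (j , (begin
  r - + 2 * j   ≡⟨ cong (_-_ r) (ℤP.*-comm (+ 2) j) ⟩
  r - j * + 2   ≡⟨ cong (λ x → r - x) r-k≡j*2 ⟨
  r - (r - k)   ≡⟨ cancel r k ⟩
  k             ∎))
  where
  open ≡-Reasoning
  cancel : ∀ r k → r - (r - k) ≡ k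
  cancel = solve-∀
... | no 2∤r-k = no λ { (j , refl) → 2∤r-k (divides j (r-[r-2e]≡e*2 r j)) }

coeff-twist : ∀ r p j → coeff (twist r p) (r - + 2 * j) ≡ coeff p j
coeff-twist r = coeff-reindex λ {e} {e′} eq → ℤP.*-cancelʳ-≡ e e′ (+ 2)
  (trans (sym (r-[r-2e]≡e*2 r e)) (trans (cong (_-_ r) eq) (r-[r-2e]≡e*2 r e′)))

twist-reflect : ∀ r j → r - + 2 * (r - j) ≡ - (r - + 2 * j)
twist-reflect = solve-∀

twist-isPoly : ∀ r p → (∀ j → r < + 2 * j → coeff p j ≡ + 0) → IsPoly (twist r p)
twist-isPoly r p high-vanish k k<0 with twist-exponent? r k
... | no k∉im        = coeff-reindex-∉ (λ e → k∉im ∘ (e ,_)) p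
... | yes (j , refl) = trans (coeff-twist r p j) (high-vanish j r<2j)
  where
  shift : ∀ r j → (r - + 2 * j) + + 2 * j ≡ r
  shift = solve-∀
  r<2j : r < + 2 * j
  r<2j = subst₂ _<_ (shift r j) (ℤP.+-identityˡ (+ 2 * j)) (ℤP.+-monoˡ-< (+ 2 * j) k<0)

twist-pal0 : ∀ m p → PalDeg m p → Pal0 (twist (+ m) p)
twist-pal0 m p pal k with twist-exponent? (+ m) k
... | yes (j , refl) = begin
  coeff (twist r p) (r - + 2 * j)          ≡⟨ coeff-twist r p j ⟩
  coeff p j                                ≡⟨ pal j ⟩
  coeff p (r - j)                          ≡⟨ coeff-twist r p (r - j) ⟨
  coeff (twist r p) (r - + 2 * (r - j))    ≡⟨ cong (coeff (twist r p)) (twist-reflect r j) ⟩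
  coeff (twist r p) (- (r - + 2 * j))      ∎
  where
  open ≡-Reasoning
  r = + m
... | no k∉im = trans (coeff-reindex-∉ (λ e → k∉im ∘ (e ,_)) p)
                      (sym (coeff-reindex-∉ -k∉im p))
  where
  -k∉im : ∀ e → + m - + 2 * e ≢ - k
  -k∉im e eq = k∉im (+ m - e , trans (twist-reflect (+ m) e)
                                     (trans (cong -_ eq) (ℤP.neg-involutive k)))

Σ-filter-[] : ∀ {A : Set} {p} {P : Pred A p} (P? : Decidable P) {f : A → Laurent} →
  (∀ x → P x → f x ≡ []) → ∀ xs → Σ[ filter P? xs ] f ≡ []
Σ-filter-[] P? f≡[] []       = refl
Σ-filter-[] P? f≡[] (x ∷ xs) with P? x
... | yes px = cong₂ _++_ (f≡[] x px) (Σ-filter-[] P? f≡[] xs)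
... | no _   = Σ-filter-[] P? f≡[] xs

Σ-filter-restrict : ∀ {A : Set} {p q} {P : Pred A p} {Q : Pred A q}
  (P? : Decidable P) (Q? : Decidable Q) {f g : A → Laurent} →
  (∀ x → P x → Q x → f x ≡ g x) → (∀ x → P x → ¬ Q x → f x ≡ []) →
  ∀ xs → Σ[ filter P? xs ] f ≡ Σ[ filter (λ x → P? x ×-dec Q? x) xs ] g
Σ-filter-restrict P? Q? f≡g f≡[] []       = refl
Σ-filter-restrict P? Q? f≡g f≡[] (x ∷ xs) with P? x | Q? x
... | yes px | yes qx = cong₂ _++_ (f≡g x px qx) (Σ-filter-restrict P? Q? f≡g f≡[] xs)
... | yes px | no ¬qx = cong₂ _++_ (f≡[] x px ¬qx) (Σ-filter-restrict P? Q? f≡g f≡[] xs)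
... | no _   | _      = Σ-filter-restrict P? Q? f≡g f≡[] xs

upperΣ : ∀ {n} (M : Matroid n) → HElem M → Subset n → Laurent
upperΣ M α G = Σ[ filter (G ⊆?_) (flats M) ] (λ H → tpow (rkℤ M G - rkℤ M H) ⊗ α H)

module _ {n} (M : Matroid n) (P : Subset n → Subset n → Laurent) {F : Subset n} where

  ζ-⊆ : ∀ {G} → G ⊆ F → ζ M P F G ≡ twist (rkℤ M F - rkℤ M G) (P G F)
  ζ-⊆ {G} G⊆F with G ⊆? F
  ... | yes _  = tpow-⊗-subst-t⁻² (rkℤ M F - rkℤ M G) (P G F)
  ... | no G⊈F = ⊥-elim (G⊈F G⊆F)

  ζ-⊈ : ∀ {G} → ¬ G ⊆ F → ζ M P F G ≡ []
  ζ-⊈ {G} G⊈F with G ⊆? F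
  ... | yes G⊆F = ⊥-elim (G⊈F G⊆F)
  ... | no _    = refl

  upperΣ-ζ-⊆ : ∀ {G} → G ⊆ F → upperΣ M (ζ M P F) G ≡ twist (rkℤ M F - rkℤ M G) (Zfun M P G F)
  upperΣ-ζ-⊆ {G} G⊆F =
    trans (Σ-filter-restrict (G ⊆?_) (_⊆? F) term beyond-F (flats M))
          (sym (map-concatMap _ (λ H → tpow (rkℤ M H - rG) ⊗ P H F) (interval M G F)))
    where
    rF = rkℤ M F
    rG = rkℤ M G
    exponent : ∀ rF rG rH → (rG - rH) + (rF - rH) ≡ (rF - rG) - + 2 * (rH - rG)
    exponent = solve-∀
    beyond-F : ∀ H → G ⊆ H → ¬ H ⊆ F → tpow (rG - rkℤ M H) ⊗ ζ M P F H ≡ []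
    beyond-F H _ H⊈F = cong (tpow (rG - rkℤ M H) ⊗_) (ζ-⊈ H⊈F)
    term : ∀ H → G ⊆ H → H ⊆ F →
      tpow (rG - rkℤ M H) ⊗ ζ M P F H ≡ twist (rF - rG) (tpow (rkℤ M H - rG) ⊗ P H F)
    term H _ H⊆F = begin
      tpow (rG - rH) ⊗ ζ M P F H                  ≡⟨ cong (tpow (rG - rH) ⊗_) (ζ-⊆ H⊆F) ⟩
      tpow (rG - rH) ⊗ twist (rF - rH) (P H F)    ≡⟨ tpow-⊗-twist (rG - rH) (rF - rH) (P H F) ⟩
      twist ((rG - rH) + (rF - rH)) (P H F)       ≡⟨ cong (λ r → twist r (P H F)) (exponent rF rG rH) ⟩
      twist ((rF - rG) - + 2 * (rH - rG)) (P H F) ≡⟨ twist-tpow-⊗ (rH - rG) (rF - rG) (P H F) ⟨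
      twist (rF - rG) (tpow (rH - rG) ⊗ P H F)    ∎
      where
      open ≡-Reasoning
      rH = rkℤ M H

  upperΣ-ζ-⊈ : ∀ {G} → ¬ G ⊆ F → upperΣ M (ζ M P F) G ≡ []
  upperΣ-ζ-⊈ {G} G⊈F = Σ-filter-[] (G ⊆?_) term-[] (flats M)
    where
    term-[] : ∀ H → G ⊆ H → tpow (rkℤ M G - rkℤ M H) ⊗ ζ M P F H ≡ []
    term-[] H G⊆H = cong (tpow (rkℤ M G - rkℤ M H) ⊗_) (ζ-⊈ λ H⊆F → G⊈F (⊆-trans G⊆H H⊆F))

rkℤ-∸ : ∀ {n} (M : Matroid n) {X Y} → X ⊆ Y → rkℤ M Y - rkℤ M X ≡ + (rk M Y ∸ rk M X)
rkℤ-∸ M {X} {Y} X⊆Y =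
  trans (ℤP.[+m]-[+n]≡m⊖n (rk M Y) (rk M X)) (ℤP.⊖-≥ (rk-mono M X⊆Y))

module _ {n} {M : Matroid n} {P : Subset n → Subset n → Laurent} (KL : IsKLFamily M P) where
  open IsKLFamily KL

  ζ-isPoly : ∀ {F G} → IsFlat M F → IsFlat M G → IsPoly (ζ M P F G)
  ζ-isPoly {F} {G} F-flat G-flat with G ⊆? F
  ... | no _    = λ _ _ → refl
  ... | yes G⊆F = subst IsPoly (sym (tpow-⊗-subst-t⁻² r (P G F))) (twist-isPoly r (P G F) high-vanish)
    where
    r = rkℤ M F - rkℤ M G
    high-vanish : ∀ j → rkℤ M F - rkℤ M G < + 2 * j → coeff (P G F) j ≡ + 0
    high-vanish j r<2j with ℕP.m≤n⇒m<n∨m≡n (rk-mono M G⊆F)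
    ... | inj₁ rG<rF = degree G F G-flat F-flat G⊆F rG<rF j
                         (ℤP.<⇒≤ (subst (_< + 2 * j) (rkℤ-∸ M G⊆F) r<2j))
    ... | inj₂ rG≡rF = trans (rank0 G F G-flat F-flat G⊆F (sym rG≡rF) j) (coeff-1L j≢0)
      where
      j≢0 : j ≢ + 0
      j≢0 refl with subst (_< + 0) (rkℤ-∸ M G⊆F) r<2j
      ... | +<+ ()

  upperΣ-ζ-Pal0 : ∀ {F G} → IsFlat M F → IsFlat M G → Pal0 (upperΣ M (ζ M P F) G)
  upperΣ-ζ-Pal0 {F} {G} F-flat G-flat with G ⊆? F
  ... | no G⊈F = subst Pal0 (sym (upperΣ-ζ-⊈ M P G⊈F)) λ _ → refl
  ... | yes G⊆F = subst Pal0 (sym (upperΣ-ζ-⊆ M P G⊆F))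
    (subst (λ r → Pal0 (twist r (Zfun M P G F))) (sym (rkℤ-∸ M G⊆F))
      (twist-pal0 (rk M F ∸ rk M G) (Zfun M P G F) (palin G F G-flat F-flat G⊆F)))

lemma2p12 : ∀ {n} (M : Matroid n) → Simple M →
    (P : Subset n → Subset n → Laurent) → IsKLFamily M P →
    ∀ F → IsFlat M F → InHp M (ζ M P F)
lemma2p12 M _ P KL F F-flat G G-flat = ζ-isPoly KL F-flat G-flat , upperΣ-ζ-Pal0 KL F-flat G-flat
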